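{- Let $n\ge 6$ be even and suppose $S(n,m) \ge \left(\frac18 - \delta\right) n^2$ where $n^{ -1/2} \le \delta \le \frac14$. Then $S(n, m+2\delta n) \ge \frac{n^2}{8}$.
   Context: A graph $G=(V,E)$ on $n$ vertices is called nice if it is $K_4$-free and there is a partition $V = X\cup Y$ into two parts each of size $n/2$ such that each of $G[X]$ and $G[Y]$ is triangle-free. $S(n,m)$ denotes the maximum number of edges of a nice graph on $n$ vertices with independence number less than $m$. Floor and ceiling signs are omitted (e.g., $2\delta n$ is treated as an integer). -}

module Defs where

open import Data.Nat using (ℕ; zero; suc; _+_; _*_; _<_; _<ᵇ_)
open import Data.Bool using (Bool; true; false; _∧_; if_then_else_)
open import Data.Fin using (Fin; toℕ)
import Data.Fin as Fin
open import Data.Fin.Subset using (Subset; _∈_; ∣_∣; ∁)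
open import Data.Integer using (+_)
open import Data.Rational using (ℚ; _/_; _≤_)
open import Data.Product using (Σ; _×_)
open import Data.Empty using (⊥)
open import Relation.Binary.PropositionalEquality using (_≡_)

ℕtoℚ : ℕ → ℚ
ℕtoℚ k = (+ k) / 1

sumFin : (n : ℕ) → (Fin n → ℕ) → ℕ
sumFin zero    f = 0
sumFin (suc n) f = f Fin.zero + sumFin n (λ i → f (Fin.suc i))

record Graph (n : ℕ) : Set where
  field
    adj   : Fin n → Fin n → Bool
    sym   : ∀ i j → adj i j ≡ adj j i
    irrfl : ∀ i → adj i i ≡ false
open Graph public

edges : {n : ℕ} → Graph n → ℕ
edges {n} G = sumFin n (λ i → sumFin n (λ j →
  if (toℕ i <ᵇ toℕ j) ∧ adj G i j then 1 else 0))

Adj : {n : ℕ} → Graph n → Fin n → Fin n → Set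
Adj G i j = adj G i j ≡ true

-- G is K₄-free (pairwise adjacent vertices are automatically distinct)
K4Free : {n : ℕ} → Graph n → Set
K4Free G = ∀ a b c d → Adj G a b → Adj G a c → Adj G a d →
  Adj G b c → Adj G b d → Adj G c d → ⊥

TriangleFreeOn : {n : ℕ} → Graph n → Subset n → Set
TriangleFreeOn G X = ∀ a b c → a ∈ X → b ∈ X → c ∈ X →
  Adj G a b → Adj G a c → Adj G b c → ⊥

Nice : {n : ℕ} → Graph n → Set
Nice {n} G = K4Free G × Σ (Subset n) (λ X →
  (∣ X ∣ + ∣ X ∣ ≡ n) × TriangleFreeOn G X × TriangleFreeOn G (∁ X))

Independent : {n : ℕ} → Graph n → Subset n → Set
Independent G I = ∀ i j → i ∈ I → j ∈ I → adj G i j ≡ false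

IndepLess : {n : ℕ} → Graph n → ℕ → Set
IndepLess G m = ∀ I → Independent G I → ∣ I ∣ < m

-- "S(n,m) ≥ t": since S(n,m) is the maximum of e(G) over nice graphs G on
-- n vertices with α(G) < m, S(n,m) ≥ t iff some such G has e(G) ≥ t.
S≥ : ℕ → ℕ → ℚ → Set
S≥ n m t = Σ (Graph n) (λ G → Nice G × IndepLess G m × (t ≤ ℕtoℚ (edges G)))

-- Write n = 2h and let X, ∁ X be the two triangle-free halves. Pick x ∈ X and y ∈ ∁ X of
-- minimum degree within their halves, and rewire them so that x is adjacent to exactly ∁ X and
-- y to exactly X. Both halves stay triangle-free, a K₄ through x or y would leave a triangle
-- inside one half, and since x ~ y an independent set loses at most one vertex when x and y are
-- deleted, so α grows by at most one. With D = 2e(G) the degree sum, the minimum-degree choice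
-- gives h (deg x + deg y) ≤ D, and the rewiring increases D by at least 4h − 2(deg x + deg y) − 2.
-- This preserves the invariant h² ≤ D + 2sh while s drops by one. The hypothesis gives it for
-- s = k = 2δn, so after k steps D ≥ h², i.e. e ≥ n²/8.
module Submission where

open import Defs hiding (sym)
open import Algebra.Properties.CommutativeSemigroup using (x∙yz≈y∙xz; xy∙z≈xz∙y)
open import Data.Bool using (Bool; true; false; _∧_; not; if_then_else_)
open import Data.Bool.Properties using (not-¬)
open import Data.Empty using (⊥; ⊥-elim)
open import Data.Fin using (Fin; zero; suc; toℕ; _≟_)
open import Data.Fin.Properties using (toℕ-injective; suc-injective)
open import Data.Fin.Subset using (Subset; ∣_∣; ∁; _∈_; _∉_; Nonempty; inside; outside)
open import Data.Fin.Subset.Properties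
  using (_∈?_; nonempty?; Empty-unique; ∣⊥∣≡0; x∈p⇒x∉∁p; x∈∁p⇒x∉p; ∣∁p∣≡n∸∣p∣)
open import Data.Integer using (+_)
import Data.Integer as ℤ
import Data.Integer.Properties as ℤ
open import Data.List using (List; _∷_; []; allFin; filter)
import Data.List.Relation.Unary.All as All
open import Data.List.Relation.Unary.All.Properties using (all-filter)
open import Data.List.Membership.Propositional.Properties using (∈-filter⁺; ∈-allFin)
open import Data.Nat using (ℕ; zero; suc; _+_; _*_; _∸_; _≤_; _<_; _<ᵇ_; z≤n; s≤s)
open import Data.Nat.Divisibility using (_∣_; ∣1⇒≡1)
open import Data.Nat.Properties
  using ( ≤-refl; ≤-reflexive; ≤-trans; ≤-antisym; ≤-totalOrder; <-asym; ≮⇒≥; >⇒≢; n≤1+n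
        ; m≤m+n; m≤n+m; +-mono-≤; +-monoˡ-≤; +-monoʳ-≤; *-monoʳ-≤; +-cancelʳ-≤; *-cancelˡ-≤
        ; +-comm; +-identityʳ; *-identityʳ; +-suc; m+n∸n≡m; <ᵇ-reflects-<
        ; +-*-semiring; +-commutativeSemigroup; module ≤-Reasoning )
open import Data.Nat.Tactic.RingSolver using (solve)
open import Data.List.Extrema ≤-totalOrder using (argmin; argmin-all; f[argmin]≤f[xs])
open import Data.Product using (∃-syntax; _×_; _,_)
open import Data.Rational using (ℚ; mkℚ; _/_; _-_; *≤*)
import Data.Rational as ℚ
import Data.Rational.Properties as ℚ
open import Data.Rational.Solver using (module +-*-Solver)
open import Data.Vec using (lookup; _[_]≔_)
open import Data.Vec.Properties using (lookup⇒[]=; []=⇒lookup; lookup-map)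
open import Function using (_∘_)
open import Relation.Nullary using (Dec; does; yes; no; contradiction)
open import Relation.Nullary.Reflects using (ofʸ; ofⁿ)
open import Relation.Binary.PropositionalEquality

open import Algebra.Properties.Semiring.Sum +-*-semiring
  using (sum-syntax; sum-cong-≗; sum-replicate-zero; ∑-distrib-+; ∑-comm)

𝟙 : Bool → ℕ
𝟙 b = if b then 1 else 0

𝟙≤1 : ∀ b → 𝟙 b ≤ 1
𝟙≤1 true  = ≤-refl
𝟙≤1 false = z≤n

∑-mono-≤ : ∀ {n} {f g : Fin n → ℕ} → (∀ i → f i ≤ g i) → ∑[ i < n ] f i ≤ ∑[ i < n ] g i
∑-mono-≤ {zero}  f≤g = z≤n
∑-mono-≤ {suc n} f≤g = +-mono-≤ (f≤g zero) (∑-mono-≤ (f≤g ∘ suc))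

∑-if-≟ : ∀ {n} (x : Fin n) (f : Fin n → ℕ) → ∑[ i < n ] (if does (i ≟ x) then f i else 0) ≡ f x
∑-if-≟ {suc n} zero    f = trans (cong (_+_ (f zero)) (sum-replicate-zero n)) (+-identityʳ (f zero))
∑-if-≟ {suc n} (suc x) f = ∑-if-≟ x (f ∘ suc)

-- Vec's constructors are opened locally: overloading _∷_ with List's slows the ring solver badly.
module _ where
  open import Data.Vec using (_∷_; []; here; there)

  ∑-if-lookup : ∀ {n} (P : Subset n) c → ∑[ i < n ] (if lookup P i then c else 0) ≡ ∣ P ∣ * c
  ∑-if-lookup []            c = refl
  ∑-if-lookup (inside  ∷ P) c = cong (_+_ c) (∑-if-lookup P c)
  ∑-if-lookup (outside ∷ P) c = ∑-if-lookup P c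

  ∣p∣≤suc∣p[x]≔outside∣ : ∀ {n} (p : Subset n) x → ∣ p ∣ ≤ suc ∣ p [ x ]≔ outside ∣
  ∣p∣≤suc∣p[x]≔outside∣ (inside  ∷ p) zero    = ≤-refl
  ∣p∣≤suc∣p[x]≔outside∣ (outside ∷ p) zero    = n≤1+n ∣ p ∣
  ∣p∣≤suc∣p[x]≔outside∣ (inside  ∷ p) (suc x) = s≤s (∣p∣≤suc∣p[x]≔outside∣ p x)
  ∣p∣≤suc∣p[x]≔outside∣ (outside ∷ p) (suc x) = ∣p∣≤suc∣p[x]≔outside∣ p x

  ∈p[x]≔outside⁻ : ∀ {n} (p : Subset n) x {i} → i ∈ p [ x ]≔ outside → i ∈ p × i ≢ x
  ∈p[x]≔outside⁻ (b ∷ p) zero    (there i∈p) = there i∈p , λ ()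
  ∈p[x]≔outside⁻ (b ∷ p) (suc x) here        = here , λ ()
  ∈p[x]≔outside⁻ (b ∷ p) (suc x) (there i∈)  with ∈p[x]≔outside⁻ p x i∈
  ... | i∈p , i≢x = there i∈p , i≢x ∘ suc-injective

∑-𝟙-lookup : ∀ {n} (P : Subset n) → ∑[ i < n ] 𝟙 (lookup P i) ≡ ∣ P ∣
∑-𝟙-lookup P = trans (∑-if-lookup P 1) (*-identityʳ ∣ P ∣)

∑-if-lookup-∁ : ∀ {n} (P : Subset n) (f : Fin n → ℕ) →
  ∑[ i < n ] (if lookup P i then f i else 0) + ∑[ i < n ] (if lookup (∁ P) i then f i else 0)
    ≡ ∑[ i < n ] f i
∑-if-lookup-∁ {n} P f = trans (sym (∑-distrib-+ {n} _ _)) (sum-cong-≗ pointwise)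
  where
  pointwise : ∀ i → (if lookup P i then f i else 0) + (if lookup (∁ P) i then f i else 0) ≡ f i
  pointwise i rewrite lookup-map i not P with lookup P i
  ... | true  = +-identityʳ (f i)
  ... | false = refl

∑∑-distrib-+ : ∀ {n} (f g : Fin n → Fin n → ℕ) →
  ∑[ i < n ] ∑[ j < n ] (f i j + g i j) ≡ ∑[ i < n ] ∑[ j < n ] f i j + ∑[ i < n ] ∑[ j < n ] g i j
∑∑-distrib-+ {n} f g = trans (sum-cong-≗ (λ i → ∑-distrib-+ (f i) (g i))) (∑-distrib-+ {n} _ _)

∑∑-if-≟ˡ : ∀ {n} (x : Fin n) (f : Fin n → Fin n → ℕ) →
  ∑[ i < n ] ∑[ j < n ] (if does (i ≟ x) then f i j else 0) ≡ ∑[ j < n ] f x j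
∑∑-if-≟ˡ {n} x f = trans (sum-cong-≗ pull-out) (∑-if-≟ x (λ i → ∑[ j < n ] f i j))
  where
  pull-out : ∀ i → ∑[ j < n ] (if does (i ≟ x) then f i j else 0)
                 ≡ (if does (i ≟ x) then ∑[ j < n ] f i j else 0)
  pull-out i with does (i ≟ x)
  ... | true  = refl
  ... | false = sum-replicate-zero n

∑∑-if-≟ʳ : ∀ {n} (x : Fin n) (f : Fin n → Fin n → ℕ) →
  ∑[ i < n ] ∑[ j < n ] (if does (j ≟ x) then f i j else 0) ≡ ∑[ i < n ] f i x
∑∑-if-≟ʳ x f = sum-cong-≗ (λ i → ∑-if-≟ x (f i))

sumFin≡∑ : ∀ n (f : Fin n → ℕ) → sumFin n f ≡ ∑[ i < n ] f i
sumFin≡∑ zero    f = refl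
sumFin≡∑ (suc n) f = cong (_+_ (f zero)) (sumFin≡∑ n (f ∘ suc))

∃-minimiser : ∀ {n} (P : Subset n) (f : Fin n → ℕ) → Nonempty P →
  ∃[ x ] x ∈ P × (∀ {i} → i ∈ P → f x ≤ f i)
∃-minimiser {n} P f (x₀ , x₀∈P) =
  argmin f x₀ candidates ,
  argmin-all f x₀∈P (all-filter (_∈? P) (allFin n)) ,
  λ i∈P → All.lookup (f[argmin]≤f[xs] x₀ candidates) (∈-filter⁺ (_∈? P) (∈-allFin _) i∈P)
  where
  candidates : List (Fin n)
  candidates = filter (_∈? P) (allFin n)

∃-below-average : ∀ {n} (P : Subset n) (f : Fin n → ℕ) → Nonempty P →
  ∃[ x ] x ∈ P × ∣ P ∣ * f x ≤ ∑[ i < n ] (if lookup P i then f i else 0)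
∃-below-average {n} P f P≢∅ with ∃-minimiser P f P≢∅
... | x , x∈P , minimal = x , x∈P , (begin
  ∣ P ∣ * f x                                  ≡⟨ ∑-if-lookup P (f x) ⟨
  ∑[ i < n ] (if lookup P i then f x else 0)  ≤⟨ ∑-mono-≤ pointwise ⟩
  ∑[ i < n ] (if lookup P i then f i else 0)  ∎)
  where
  open ≤-Reasoning
  pointwise : ∀ i → (if lookup P i then f x else 0) ≤ (if lookup P i then f i else 0)
  pointwise i with lookup P i in e
  ... | true  = minimal (lookup⇒[]= i P e)
  ... | false = z≤n

nonempty-if-0<∣p∣ : ∀ {n} (p : Subset n) → 0 < ∣ p ∣ → Nonempty p
nonempty-if-0<∣p∣ {n} p 0<∣p∣ with nonempty? p
... | yes p≢∅ = p≢∅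
... | no p≡∅  = contradiction (trans (cong ∣_∣ (Empty-unique p≡∅)) (∣⊥∣≡0 n)) (>⇒≢ 0<∣p∣)

∉⇒lookup≡outside : ∀ {n} (p : Subset n) {x} → x ∉ p → lookup p x ≡ outside
∉⇒lookup≡outside p {x} x∉p with lookup p x in e
... | true  = contradiction (lookup⇒[]= x p e) x∉p
... | false = refl

deg : ∀ {n} → Graph n → Fin n → ℕ
deg {n} G i = ∑[ j < n ] 𝟙 (adj G i j)

degreeSum : ∀ {n} → Graph n → ℕ
degreeSum {n} G = ∑[ i < n ] deg G i

degreeSum≡2·edges : ∀ {n} (G : Graph n) → degreeSum G ≡ edges G + edges G
degreeSum≡2·edges {n} G = begin
  ∑[ i < n ] ∑[ j < n ] 𝟙 (adj G i j)
    ≡⟨ sum-cong-≗ (λ i → sum-cong-≗ (adj≡upper+upper i)) ⟩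
  ∑[ i < n ] ∑[ j < n ] (upper i j + upper j i)
    ≡⟨ ∑∑-distrib-+ upper (λ i j → upper j i) ⟩
  ∑[ i < n ] ∑[ j < n ] upper i j + ∑[ i < n ] ∑[ j < n ] upper j i
    ≡⟨ cong (_+_ (∑[ i < n ] ∑[ j < n ] upper i j)) (∑-comm (λ i j → upper j i)) ⟩
  ∑[ i < n ] ∑[ j < n ] upper i j + ∑[ i < n ] ∑[ j < n ] upper i j
    ≡⟨ cong₂ _+_ edges≡∑∑upper edges≡∑∑upper ⟨
  edges G + edges G ∎
  where
  open ≡-Reasoning
  upper : Fin n → Fin n → ℕ
  upper i j = 𝟙 ((toℕ i <ᵇ toℕ j) ∧ adj G i j)
  edges≡∑∑upper : edges G ≡ ∑[ i < n ] ∑[ j < n ] upper i j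
  edges≡∑∑upper = trans (sumFin≡∑ n _) (sum-cong-≗ (λ i → sumFin≡∑ n (upper i)))
  adj≡upper+upper : ∀ i j → 𝟙 (adj G i j) ≡ upper i j + upper j i
  adj≡upper+upper i j
    with toℕ i <ᵇ toℕ j | <ᵇ-reflects-< (toℕ i) (toℕ j)
       | toℕ j <ᵇ toℕ i | <ᵇ-reflects-< (toℕ j) (toℕ i)
  ... | true  | ofʸ i<j | true  | ofʸ j<i = ⊥-elim (<-asym i<j j<i)
  ... | true  | _       | false | _       = sym (+-identityʳ _)
  ... | false | _       | true  | _       rewrite Graph.sym G i j = refl
  ... | false | ofⁿ i≮j | false | ofⁿ j≮i
    rewrite toℕ-injective (≤-antisym (≮⇒≥ j≮i) (≮⇒≥ i≮j)) | irrfl G j = refl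

rewire : ∀ {n} (G : Graph n) (v : Fin n) (N : Subset n) → v ∉ N → Graph n
rewire {n} G v N v∉N = record { adj = adj′ ; sym = sym′ ; irrfl = irrfl′ }
  where
  adj′ : Fin n → Fin n → Bool
  adj′ i j = if does (i ≟ v) then lookup N j else if does (j ≟ v) then lookup N i else adj G i j
  sym′ : ∀ i j → adj′ i j ≡ adj′ j i
  sym′ i j with i ≟ v | j ≟ v
  ... | yes refl | yes refl = refl
  ... | yes refl | no _     = refl
  ... | no _     | yes refl = refl
  ... | no _     | no _     = Graph.sym G i j
  irrfl′ : ∀ i → adj′ i i ≡ false
  irrfl′ i with i ≟ v
  ... | yes refl = ∉⇒lookup≡outside N v∉N
  ... | no _     = irrfl G i

module _ {n} (G : Graph n) (v : Fin n) (N : Subset n) (v∉N : v ∉ N) where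

  private
    G′ : Graph n
    G′ = rewire G v N v∉N

  rewire-adjˡ : ∀ j → adj G′ v j ≡ lookup N j
  rewire-adjˡ j with v ≟ v
  ... | yes _   = refl
  ... | no v≢v = contradiction refl v≢v

  rewire-adjʳ : ∀ i → adj G′ i v ≡ lookup N i
  rewire-adjʳ i = trans (Graph.sym G′ i v) (rewire-adjˡ i)

  rewire-adj-away : ∀ {i j} → i ≢ v → j ≢ v → adj G′ i j ≡ adj G i j
  rewire-adj-away {i} {j} i≢v j≢v with i ≟ v | j ≟ v
  ... | yes i≡v | _       = contradiction i≡v i≢v
  ... | no _    | yes j≡v = contradiction j≡v j≢v
  ... | no _    | no _    = refl

  Adj-rewireˡ⇒∈ : ∀ {j} → Adj G′ v j → j ∈ N
  Adj-rewireˡ⇒∈ {j} vj = lookup⇒[]= j N (trans (sym (rewire-adjˡ j)) vj)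

  Adj-rewireʳ⇒∈ : ∀ {i} → Adj G′ i v → i ∈ N
  Adj-rewireʳ⇒∈ {i} iv = lookup⇒[]= i N (trans (sym (rewire-adjʳ i)) iv)

  Adj-rewire-away : ∀ {i j} → i ≢ v → j ≢ v → Adj G′ i j → Adj G i j
  Adj-rewire-away i≢v j≢v ij = trans (sym (rewire-adj-away i≢v j≢v)) ij

  rewire-triangleFree : ∀ {S} → TriangleFreeOn G S → (v ∈ S → ∀ {j} → j ∈ S → j ∉ N) →
    TriangleFreeOn G′ S
  rewire-triangleFree triangleFree N-avoids-S a b c a∈S b∈S c∈S ab ac bc =
    go (a ≟ v) (b ≟ v) (c ≟ v)
    where
    go : Dec (a ≡ v) → Dec (b ≡ v) → Dec (c ≡ v) → ⊥
    go (yes refl) _          _          = N-avoids-S a∈S b∈S (Adj-rewireˡ⇒∈ ab)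
    go (no _)     (yes refl) _          = N-avoids-S b∈S a∈S (Adj-rewireʳ⇒∈ ab)
    go (no _)     (no _)     (yes refl) = N-avoids-S c∈S a∈S (Adj-rewireʳ⇒∈ ac)
    go (no a≢v)   (no b≢v)   (no c≢v)   = triangleFree a b c a∈S b∈S c∈S
      (Adj-rewire-away a≢v b≢v ab) (Adj-rewire-away a≢v c≢v ac) (Adj-rewire-away b≢v c≢v bc)

  rewire-triangleFree-N : TriangleFreeOn G N → TriangleFreeOn G′ N
  rewire-triangleFree-N N-triangleFree =
    rewire-triangleFree N-triangleFree (λ v∈N → contradiction v∈N v∉N)

  rewire-K4Free : K4Free G → TriangleFreeOn G N → K4Free G′
  rewire-K4Free K4free N-triangleFree a b c d ab ac ad bc bd cd =
    go (a ≟ v) (b ≟ v) (c ≟ v) (d ≟ v)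
    where
    triangle : TriangleFreeOn G′ N
    triangle = rewire-triangleFree-N N-triangleFree
    go : Dec (a ≡ v) → Dec (b ≡ v) → Dec (c ≡ v) → Dec (d ≡ v) → ⊥
    go (yes refl) _ _ _ =
      triangle b c d (Adj-rewireˡ⇒∈ ab) (Adj-rewireˡ⇒∈ ac) (Adj-rewireˡ⇒∈ ad) bc bd cd
    go (no _) (yes refl) _ _ =
      triangle a c d (Adj-rewireʳ⇒∈ ab) (Adj-rewireˡ⇒∈ bc) (Adj-rewireˡ⇒∈ bd) ac ad cd
    go (no _) (no _) (yes refl) _ =
      triangle a b d (Adj-rewireʳ⇒∈ ac) (Adj-rewireʳ⇒∈ bc) (Adj-rewireˡ⇒∈ cd) ab ad bd
    go (no _) (no _) (no _) (yes refl) =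
      triangle a b c (Adj-rewireʳ⇒∈ ad) (Adj-rewireʳ⇒∈ bd) (Adj-rewireʳ⇒∈ cd) ab ac bc
    go (no a≢v) (no b≢v) (no c≢v) (no d≢v) = K4free a b c d
      (Adj-rewire-away a≢v b≢v ab) (Adj-rewire-away a≢v c≢v ac) (Adj-rewire-away a≢v d≢v ad)
      (Adj-rewire-away b≢v c≢v bc) (Adj-rewire-away b≢v d≢v bd) (Adj-rewire-away c≢v d≢v cd)

  rewire-triangleFreeSplit : ∀ {S} → (∀ {j} → j ∈ S → j ∉ N) →
    K4Free G → TriangleFreeOn G S → TriangleFreeOn G N →
    K4Free G′ × TriangleFreeOn G′ S × TriangleFreeOn G′ N
  rewire-triangleFreeSplit S∩N≡∅ K4free S-triangleFree N-triangleFree =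
    rewire-K4Free K4free N-triangleFree ,
    rewire-triangleFree S-triangleFree (λ _ → S∩N≡∅) ,
    rewire-triangleFree-N N-triangleFree

  rewire-degreeSum : degreeSum G′ + (deg G v + deg G v) ≡ degreeSum G + (∣ N ∣ + ∣ N ∣)
  rewire-degreeSum = begin
    degreeSum G′ + (deg G v + deg G v)
      ≡⟨ cong₂ (λ a b → degreeSum G′ + (a + b)) (∑∑-if-≟ˡ v A) (∑∑-if-≟ʳ v Aᵀ) ⟨
    degreeSum G′ + (∑∑ (rowᵥ A) + ∑∑ (colᵥ Aᵀ))
      ≡⟨ ∑∑-distrib-+₃ (λ i j → 𝟙 (adj G′ i j)) (rowᵥ A) (colᵥ Aᵀ) ⟨
    ∑∑ (λ i j → 𝟙 (adj G′ i j) + (rowᵥ A i j + colᵥ Aᵀ i j))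
      ≡⟨ sum-cong-≗ (λ i → sum-cong-≗ (pointwise i)) ⟩
    ∑∑ (λ i j → A i j + (rowᵥ Nʳ i j + colᵥ Nˡ i j))
      ≡⟨ ∑∑-distrib-+₃ A (rowᵥ Nʳ) (colᵥ Nˡ) ⟩
    degreeSum G + (∑∑ (rowᵥ Nʳ) + ∑∑ (colᵥ Nˡ))
      ≡⟨ cong₂ (λ a b → degreeSum G + (a + b)) (trans (∑∑-if-≟ˡ v Nʳ) (∑-𝟙-lookup N))
                                              (trans (∑∑-if-≟ʳ v Nˡ) (∑-𝟙-lookup N)) ⟩
    degreeSum G + (∣ N ∣ + ∣ N ∣) ∎
    where
    open ≡-Reasoning
    ∑∑ : (Fin n → Fin n → ℕ) → ℕ
    ∑∑ f = ∑[ i < n ] ∑[ j < n ] f i j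
    ∑∑-distrib-+₃ : ∀ f g h → ∑∑ (λ i j → f i j + (g i j + h i j)) ≡ ∑∑ f + (∑∑ g + ∑∑ h)
    ∑∑-distrib-+₃ f g h = trans (∑∑-distrib-+ f _) (cong (_+_ (∑∑ f)) (∑∑-distrib-+ g h))
    A Aᵀ Nˡ Nʳ : Fin n → Fin n → ℕ
    A i j = 𝟙 (adj G i j)
    Aᵀ i j = 𝟙 (adj G j i)
    Nˡ i j = 𝟙 (lookup N i)
    Nʳ i j = 𝟙 (lookup N j)
    rowᵥ colᵥ : (Fin n → Fin n → ℕ) → Fin n → Fin n → ℕ
    rowᵥ f i j = if does (i ≟ v) then f i j else 0
    colᵥ f i j = if does (j ≟ v) then f i j else 0
    pointwise : ∀ i j → 𝟙 (adj G′ i j) + (rowᵥ A i j + colᵥ Aᵀ i j)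
                      ≡ A i j + (rowᵥ Nʳ i j + colᵥ Nˡ i j)
    pointwise i j with i ≟ v | j ≟ v
    ... | yes refl | yes refl rewrite irrfl G v | ∉⇒lookup≡outside N v∉N = refl
    ... | yes refl | no _     = x∙yz≈y∙xz +-commutativeSemigroup (Nʳ v j) (A v j) 0
    ... | no _     | yes refl rewrite Graph.sym G v i = +-comm (Nˡ i v) (A i v)
    ... | no _     | no _     = refl

  rewire-deg-≤ : ∀ {i} → i ≢ v → deg G′ i ≤ deg G i + 1
  rewire-deg-≤ {i} i≢v = begin
    ∑[ j < n ] 𝟙 (adj G′ i j)                                     ≤⟨ ∑-mono-≤ pointwise ⟩
    ∑[ j < n ] (𝟙 (adj G i j) + (if does (j ≟ v) then 1 else 0)) ≡⟨ ∑-distrib-+ {n} _ _ ⟩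
    deg G i + ∑[ j < n ] (if does (j ≟ v) then 1 else 0)          ≡⟨ cong (_+_ (deg G i)) (∑-if-≟ v (λ _ → 1)) ⟩
    deg G i + 1                                                    ∎
    where
    open ≤-Reasoning
    pointwise : ∀ j → 𝟙 (adj G′ i j) ≤ 𝟙 (adj G i j) + (if does (j ≟ v) then 1 else 0)
    pointwise j with i ≟ v | j ≟ v
    ... | yes i≡v | _        = contradiction i≡v i≢v
    ... | no _    | yes refl = ≤-trans (𝟙≤1 _) (m≤n+m 1 _)
    ... | no _    | no _     = m≤m+n _ 0

IndepLess-suc : ∀ {n} {G G′ : Graph n} {x y m} → Adj G′ x y →
  (∀ {i j} → i ≢ x → i ≢ y → j ≢ x → j ≢ y → adj G′ i j ≡ adj G i j) →
  IndepLess G m → IndepLess G′ (suc m)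
IndepLess-suc {G = G} {G′} {x} {y} {m} xy agree α<m I independent = removeOne (x ∈? I)
  where
  remove : ∀ z → (∀ {i} → i ∈ I → i ≢ z → i ≢ x × i ≢ y) → ∣ I ∣ < suc m
  remove z avoids = s≤s (≤-trans (∣p∣≤suc∣p[x]≔outside∣ I z) (α<m _ independent-in-G))
    where
    independent-in-G : Independent G (I [ z ]≔ outside)
    independent-in-G i j i∈ j∈ with ∈p[x]≔outside⁻ I z i∈ | ∈p[x]≔outside⁻ I z j∈
    ... | i∈I , i≢z | j∈I , j≢z with avoids i∈I i≢z | avoids j∈I j≢z
    ... | i≢x , i≢y | j≢x , j≢y = trans (sym (agree i≢x i≢y j≢x j≢y)) (independent i j i∈I j∈I)
  removeOne : Dec (x ∈ I) → ∣ I ∣ < suc m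
  removeOne (no x∉I)  = remove y (λ i∈I i≢y → (λ { refl → x∉I i∈I }) , i≢y)
  removeOne (yes x∈I) = remove x (λ i∈I i≢x → i≢x , λ { refl → not-¬ xy (independent x y x∈I i∈I) })

NiceWith : ∀ {n} → Graph n → Subset n → Set
NiceWith G X = K4Free G × TriangleFreeOn G X × TriangleFreeOn G (∁ X)

joinAcross : ∀ {n} (G : Graph n) (X : Subset n) {x y} → x ∈ X → y ∈ ∁ X → Graph n
joinAcross G X {x} {y} x∈X y∈∁X =
  rewire (rewire G x (∁ X) (x∈p⇒x∉∁p x∈X)) y X (x∈∁p⇒x∉p y∈∁X)

module _ {n} (G : Graph n) (X : Subset n) {x y} (x∈X : x ∈ X) (y∈∁X : y ∈ ∁ X) where

  private
    x∉∁X : x ∉ ∁ X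
    x∉∁X = x∈p⇒x∉∁p x∈X
    y∉X : y ∉ X
    y∉X = x∈∁p⇒x∉p y∈∁X
    G₁ G₂ : Graph n
    G₁ = rewire G x (∁ X) x∉∁X
    G₂ = joinAcross G X x∈X y∈∁X

  joinAcross-NiceWith : NiceWith G X → NiceWith G₂ X
  joinAcross-NiceWith (K4free , X-triangleFree , ∁X-triangleFree)
    with rewire-triangleFreeSplit G x (∁ X) x∉∁X x∈p⇒x∉∁p K4free X-triangleFree ∁X-triangleFree
  ... | K4free₁ , X-triangleFree₁ , ∁X-triangleFree₁
    with rewire-triangleFreeSplit G₁ y X y∉X x∈∁p⇒x∉p K4free₁ ∁X-triangleFree₁ X-triangleFree₁
  ... | K4free₂ , ∁X-triangleFree₂ , X-triangleFree₂ = K4free₂ , X-triangleFree₂ , ∁X-triangleFree₂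

  joinAcross-IndepLess : ∀ {m} → IndepLess G m → IndepLess G₂ (suc m)
  joinAcross-IndepLess = IndepLess-suc {G = G} {G₂} {x} {y} x~y agree
    where
    x~y : Adj G₂ x y
    x~y = trans (rewire-adjʳ G₁ y X y∉X x) ([]=⇒lookup x∈X)
    agree : ∀ {i j} → i ≢ x → i ≢ y → j ≢ x → j ≢ y → adj G₂ i j ≡ adj G i j
    agree i≢x i≢y j≢x j≢y =
      trans (rewire-adj-away G₁ y X y∉X i≢y j≢y) (rewire-adj-away G x (∁ X) x∉∁X i≢x j≢x)

  joinAcross-degreeSum :
    degreeSum G + (∣ ∁ X ∣ + ∣ ∁ X ∣) + (∣ X ∣ + ∣ X ∣)
      ≤ degreeSum G₂ + ((deg G y + 1) + (deg G y + 1)) + (deg G x + deg G x)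
  joinAcross-degreeSum = begin
    degreeSum G + (∣ ∁ X ∣ + ∣ ∁ X ∣) + (∣ X ∣ + ∣ X ∣)
      ≡⟨ cong (_+ (∣ X ∣ + ∣ X ∣)) (rewire-degreeSum G x (∁ X) x∉∁X) ⟨
    degreeSum G₁ + (deg G x + deg G x) + (∣ X ∣ + ∣ X ∣)
      ≡⟨ xy∙z≈xz∙y +-commutativeSemigroup (degreeSum G₁) (deg G x + deg G x) _ ⟩
    degreeSum G₁ + (∣ X ∣ + ∣ X ∣) + (deg G x + deg G x)
      ≡⟨ cong (_+ (deg G x + deg G x)) (rewire-degreeSum G₁ y X y∉X) ⟨
    degreeSum G₂ + (deg G₁ y + deg G₁ y) + (deg G x + deg G x)
      ≤⟨ +-monoˡ-≤ _ (+-monoʳ-≤ (degreeSum G₂) (+-mono-≤ deg₁y≤ deg₁y≤)) ⟩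
    degreeSum G₂ + ((deg G y + 1) + (deg G y + 1)) + (deg G x + deg G x) ∎
    where
    open ≤-Reasoning
    deg₁y≤ : deg G₁ y ≤ deg G y + 1
    deg₁y≤ = rewire-deg-≤ G x (∁ X) x∉∁X (λ { refl → y∉X x∈X })

lowDegreePair : ∀ {n} (G : Graph n) (X : Subset n) → Nonempty X → Nonempty (∁ X) →
  ∃[ x ] ∃[ y ] x ∈ X × y ∈ ∁ X × ∣ X ∣ * deg G x + ∣ ∁ X ∣ * deg G y ≤ degreeSum G
lowDegreePair G X X≢∅ ∁X≢∅ with ∃-below-average X (deg G) X≢∅ | ∃-below-average (∁ X) (deg G) ∁X≢∅
... | x , x∈X , x-below | y , y∈∁X , y-below =
  x , y , x∈X , y∈∁X , ≤-trans (+-mono-≤ x-below y-below) (≤-reflexive (∑-if-lookup-∁ X (deg G)))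

-- The hypotheses give D′ ≥ (1 − 2/h) D + 4h − 2; the proof multiplies through by h to stay in ℕ.
deficit-step : ∀ {h} → 2 ≤ h → ∀ s D D′ dx dy →
  D + (h + h) + (h + h) ≤ D′ + ((dy + 1) + (dy + 1)) + (dx + dx) →
  h * dx + h * dy ≤ D →
  h * h ≤ D + suc s * (h + h) →
  h * h ≤ D′ + s * (h + h)
deficit-step {h@(suc (suc g))} (s≤s (s≤s _)) s D D′ dx dy step below-average deficit =
  *-cancelˡ-≤ h (+-cancelʳ-≤ (2 * (h * h)) _ _ (begin
    h * (h * h) + 2 * (h * h)                   ≡⟨ solve (g ∷ []) ⟩
    g * (h * h) + 4 * (h * h)                   ≤⟨ +-monoˡ-≤ (4 * (h * h)) (*-monoʳ-≤ g deficit) ⟩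
    g * (D + suc s * (h + h)) + 4 * (h * h)     ≡⟨ solve (g ∷ s ∷ D ∷ []) ⟩
    g * D + 4 * (h * h) + g * (suc s * (h + h)) ≤⟨ +-monoˡ-≤ (g * (suc s * (h + h))) scaled-step ⟩
    h * D′ + 2 * h + g * (suc s * (h + h))      ≤⟨ m≤m+n _ (4 * s * h + 2 * h) ⟩
    h * D′ + 2 * h + g * (suc s * (h + h)) + (4 * s * h + 2 * h)
                                                 ≡⟨ solve (g ∷ s ∷ D′ ∷ []) ⟩
    h * (D′ + s * (h + h)) + 2 * (h * h)        ∎))
  where
  open ≤-Reasoning
  scaled-step : g * D + 4 * (h * h) ≤ h * D′ + 2 * h
  scaled-step = +-cancelʳ-≤ (2 * D) _ _ (begin
    g * D + 4 * (h * h) + 2 * D                  ≡⟨ solve (g ∷ D ∷ []) ⟩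
    h * (D + (h + h) + (h + h))                  ≤⟨ *-monoʳ-≤ h step ⟩
    h * (D′ + ((dy + 1) + (dy + 1)) + (dx + dx)) ≡⟨ solve (g ∷ D′ ∷ dx ∷ dy ∷ []) ⟩
    h * D′ + 2 * h + 2 * (h * dx + h * dy)       ≤⟨ +-monoʳ-≤ (h * D′ + 2 * h) (*-monoʳ-≤ 2 below-average) ⟩
    h * D′ + 2 * h + 2 * D                       ∎)

joinAcross-step : ∀ {n} {G : Graph n} {X : Subset n} {m} s → 2 ≤ ∣ X ∣ → ∣ ∁ X ∣ ≡ ∣ X ∣ →
  NiceWith G X → IndepLess G m → ∣ X ∣ * ∣ X ∣ ≤ degreeSum G + suc s * (∣ X ∣ + ∣ X ∣) →
  ∃[ G′ ] NiceWith G′ X × IndepLess G′ (suc m) × ∣ X ∣ * ∣ X ∣ ≤ degreeSum G′ + s * (∣ X ∣ + ∣ X ∣)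
joinAcross-step {G = G} {X} s 2≤∣X∣ ∣∁X∣≡∣X∣ nice α<m deficit
  with lowDegreePair G X (nonempty-if-0<∣p∣ X 0<∣X∣)
                         (nonempty-if-0<∣p∣ (∁ X) (subst (0 <_) (sym ∣∁X∣≡∣X∣) 0<∣X∣))
  where
  0<∣X∣ : 0 < ∣ X ∣
  0<∣X∣ = ≤-trans (s≤s z≤n) 2≤∣X∣
... | x , y , x∈X , y∈∁X , below-average =
  G₂ , joinAcross-NiceWith G X x∈X y∈∁X nice , joinAcross-IndepLess G X x∈X y∈∁X α<m ,
  deficit-step 2≤∣X∣ s (degreeSum G) (degreeSum G₂) (deg G x) (deg G y)
    (≤-trans (≤-reflexive (cong (λ c → degreeSum G + (c + c) + (∣ X ∣ + ∣ X ∣)) (sym ∣∁X∣≡∣X∣)))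
             (joinAcross-degreeSum G X x∈X y∈∁X))
    (≤-trans (≤-reflexive (cong (λ c → ∣ X ∣ * deg G x + c * deg G y) (sym ∣∁X∣≡∣X∣))) below-average)
    deficit
  where
  G₂ : Graph _
  G₂ = joinAcross G X x∈X y∈∁X

joinAcross-iterate : ∀ {n} {G : Graph n} {X : Subset n} {m} s → 2 ≤ ∣ X ∣ → ∣ ∁ X ∣ ≡ ∣ X ∣ →
  NiceWith G X → IndepLess G m → ∣ X ∣ * ∣ X ∣ ≤ degreeSum G + s * (∣ X ∣ + ∣ X ∣) →
  ∃[ G′ ] NiceWith G′ X × IndepLess G′ (m + s) × ∣ X ∣ * ∣ X ∣ ≤ degreeSum G′
joinAcross-iterate {G = G} {m = m} zero _ _ nice α<m deficit =
  G , nice , subst (IndepLess G) (sym (+-identityʳ m)) α<m , subst (_ ≤_) (+-identityʳ _) deficit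
joinAcross-iterate {G = G} {m = m} (suc s) 2≤∣X∣ ∣∁X∣≡∣X∣ nice α<m deficit
  with joinAcross-step {G = G} s 2≤∣X∣ ∣∁X∣≡∣X∣ nice α<m deficit
... | G₁ , nice₁ , α₁ , deficit₁ with joinAcross-iterate {G = G₁} s 2≤∣X∣ ∣∁X∣≡∣X∣ nice₁ α₁ deficit₁
... | G′ , nice′ , α′ , bound = G′ , nice′ , subst (IndepLess G′) (sym (+-suc m s)) α′ , bound

ℕtoℚ≡mkℚ : ∀ a → ℕtoℚ a ≡ mkℚ (+ a) 0 (λ (_ , d∣1) → ∣1⇒≡1 d∣1)
ℕtoℚ≡mkℚ a = ℚ.↥p/↧p≡p (mkℚ (+ a) 0 _)

ℕtoℚ-homo-+ : ∀ a b → ℕtoℚ (a + b) ≡ ℕtoℚ a ℚ.+ ℕtoℚ b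
ℕtoℚ-homo-+ a b = sym (trans (cong₂ ℚ._+_ (ℕtoℚ≡mkℚ a) (ℕtoℚ≡mkℚ b)) (ℚ./-cong numerator refl))
  where
  numerator : + a ℤ.* + 1 ℤ.+ + b ℤ.* + 1 ≡ + (a + b)
  numerator = trans (cong₂ ℤ._+_ (ℤ.*-identityʳ (+ a)) (ℤ.*-identityʳ (+ b))) (sym (ℤ.pos-+ a b))

ℕtoℚ-homo-* : ∀ a b → ℕtoℚ (a * b) ≡ ℕtoℚ a ℚ.* ℕtoℚ b
ℕtoℚ-homo-* a b =
  sym (trans (cong₂ ℚ._*_ (ℕtoℚ≡mkℚ a) (ℕtoℚ≡mkℚ b)) (ℚ./-cong (sym (ℤ.pos-* a b)) refl))

ℕtoℚ-mono-≤ : ∀ {a b} → a ≤ b → ℕtoℚ a ℚ.≤ ℕtoℚ b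
ℕtoℚ-mono-≤ {a} {b} a≤b = subst₂ ℚ._≤_ (sym (ℕtoℚ≡mkℚ a)) (sym (ℕtoℚ≡mkℚ b))
  (*≤* (subst₂ ℤ._≤_ (sym (ℤ.*-identityʳ (+ a))) (sym (ℤ.*-identityʳ (+ b))) (ℤ.+≤+ a≤b)))

ℕtoℚ-cancel-≤ : ∀ {a b} → ℕtoℚ a ℚ.≤ ℕtoℚ b → a ≤ b
ℕtoℚ-cancel-≤ {a} {b} a≤b with subst₂ ℚ._≤_ (ℕtoℚ≡mkℚ a) (ℕtoℚ≡mkℚ b) a≤b
... | *≤* a*1≤b*1 = ℤ.drop‿+≤+ (subst₂ ℤ._≤_ (ℤ.*-identityʳ (+ a)) (ℤ.*-identityʳ (+ b)) a*1≤b*1)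

ℕtoℚ-homo-double² : ∀ h → ℕtoℚ ((h + h) * (h + h)) ≡ (ℕtoℚ h ℚ.+ ℕtoℚ h) ℚ.* (ℕtoℚ h ℚ.+ ℕtoℚ h)
ℕtoℚ-homo-double² h = trans (ℕtoℚ-homo-* (h + h) (h + h)) (cong₂ ℚ._*_ (ℕtoℚ-homo-+ h h) (ℕtoℚ-homo-+ h h))

h²≤2e+k·2h : ∀ {n} h e k (δ : ℚ) → h + h ≡ n → ℕtoℚ 2 ℚ.* δ ℚ.* ℕtoℚ n ≡ ℕtoℚ k →
  ((+ 1 / 8) - δ) ℚ.* ℕtoℚ (n * n) ℚ.≤ ℕtoℚ e → h * h ≤ (e + e) + k * (h + h)
h²≤2e+k·2h h e k δ refl 2δn≡k e-lower = ℕtoℚ-cancel-≤ (begin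
  ℕtoℚ (h * h)
    ≡⟨ ℕtoℚ-homo-* h h ⟩
  H ℚ.* H
    ≡⟨ +-*-Solver.solve 2 (λ δ H → let Y = (con (+ 1 / 8) :- δ) :* ((H :+ H) :* (H :+ H)) in
         H :* H := (Y :+ Y) :+ (con (ℕtoℚ 2) :* δ :* (H :+ H)) :* (H :+ H)) refl δ H ⟩
  (Y′ ℚ.+ Y′) ℚ.+ (ℕtoℚ 2 ℚ.* δ ℚ.* (H ℚ.+ H)) ℚ.* (H ℚ.+ H)
    ≡⟨ cong₂ (λ y t → (y ℚ.+ y) ℚ.+ t ℚ.* (H ℚ.+ H))
         (cong (((+ 1 / 8) - δ) ℚ.*_) (sym (ℕtoℚ-homo-double² h)))
         (trans (cong (ℕtoℚ 2 ℚ.* δ ℚ.*_) (sym (ℕtoℚ-homo-+ h h))) 2δn≡k) ⟩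
  (Y″ ℚ.+ Y″) ℚ.+ ℕtoℚ k ℚ.* (H ℚ.+ H)
    ≤⟨ ℚ.+-monoˡ-≤ (ℕtoℚ k ℚ.* (H ℚ.+ H)) (ℚ.+-mono-≤ e-lower e-lower) ⟩
  (ℕtoℚ e ℚ.+ ℕtoℚ e) ℚ.+ ℕtoℚ k ℚ.* (H ℚ.+ H)
    ≡⟨ trans (ℕtoℚ-homo-+ (e + e) _)
         (cong₂ ℚ._+_ (ℕtoℚ-homo-+ e e) (trans (ℕtoℚ-homo-* k _) (cong (ℕtoℚ k ℚ.*_) (ℕtoℚ-homo-+ h h)))) ⟨
  ℕtoℚ ((e + e) + k * (h + h)) ∎)
  where
  open ℚ.≤-Reasoning
  open +-*-Solver using (_:+_; _:*_; _:-_; con; _:=_)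
  H Y′ Y″ : ℚ
  H = ℕtoℚ h
  Y′ = ((+ 1 / 8) - δ) ℚ.* ((H ℚ.+ H) ℚ.* (H ℚ.+ H))
  Y″ = ((+ 1 / 8) - δ) ℚ.* ℕtoℚ ((h + h) * (h + h))

n²/8≤e : ∀ {n} h e → h + h ≡ n → h * h ≤ e + e → (+ 1 / 8) ℚ.* ℕtoℚ (n * n) ℚ.≤ ℕtoℚ e
n²/8≤e h e refl h²≤2e = begin
  (+ 1 / 8) ℚ.* ℕtoℚ ((h + h) * (h + h))
    ≡⟨ cong ((+ 1 / 8) ℚ.*_) (ℕtoℚ-homo-double² h) ⟩
  (+ 1 / 8) ℚ.* ((H ℚ.+ H) ℚ.* (H ℚ.+ H))
    ≡⟨ +-*-Solver.solve 1 (λ H → con (+ 1 / 8) :* ((H :+ H) :* (H :+ H)) := con (+ 1 / 2) :* (H :* H)) refl H ⟩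
  (+ 1 / 2) ℚ.* (H ℚ.* H)
    ≡⟨ cong ((+ 1 / 2) ℚ.*_) (ℕtoℚ-homo-* h h) ⟨
  (+ 1 / 2) ℚ.* ℕtoℚ (h * h)
    ≤⟨ ℚ.*-monoˡ-≤-nonNeg (+ 1 / 2) (ℕtoℚ-mono-≤ h²≤2e) ⟩
  (+ 1 / 2) ℚ.* ℕtoℚ (e + e)
    ≡⟨ cong ((+ 1 / 2) ℚ.*_) (ℕtoℚ-homo-+ e e) ⟩
  (+ 1 / 2) ℚ.* (E ℚ.+ E)
    ≡⟨ +-*-Solver.solve 1 (λ E → con (+ 1 / 2) :* (E :+ E) := E) refl E ⟩
  E ∎
  where
  open ℚ.≤-Reasoning
  open +-*-Solver using (_:+_; _:*_; con; _:=_)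
  H E : ℚ
  H = ℕtoℚ h
  E = ℕtoℚ e

2≤h-if-6≤h+h : ∀ h → 6 ≤ h + h → 2 ≤ h
2≤h-if-6≤h+h (suc (suc h)) _ = s≤s (s≤s z≤n)
2≤h-if-6≤h+h (suc zero) (s≤s (s≤s ()))

corollary9p2 : (n m k : ℕ) (δ : ℚ) → 6 ≤ n → 2 ∣ n →
    ℕtoℚ 2 ℚ.* δ ℚ.* ℕtoℚ n ≡ ℕtoℚ k →
    ℚ.0ℚ ℚ.≤ δ → ℚ.1ℚ ℚ.≤ ℕtoℚ n ℚ.* (δ ℚ.* δ) → δ ℚ.≤ (+ 1 / 4) →
    S≥ n m (((+ 1 / 8) - δ) ℚ.* ℕtoℚ (n * n)) →
    S≥ n (m + k) ((+ 1 / 8) ℚ.* ℕtoℚ (n * n))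
corollary9p2 n m k δ 6≤n _ 2δn≡k _ _ _
             (G , (K4free , X , ∣X∣+∣X∣≡n , X-triangleFree , ∁X-triangleFree) , α<m , e-lower)
  with joinAcross-iterate {G = G} k 2≤∣X∣ ∣∁X∣≡∣X∣ (K4free , X-triangleFree , ∁X-triangleFree) α<m deficit
  where
  2≤∣X∣ : 2 ≤ ∣ X ∣
  2≤∣X∣ = 2≤h-if-6≤h+h ∣ X ∣ (subst (6 ≤_) (sym ∣X∣+∣X∣≡n) 6≤n)
  ∣∁X∣≡∣X∣ : ∣ ∁ X ∣ ≡ ∣ X ∣
  ∣∁X∣≡∣X∣ = trans (∣∁p∣≡n∸∣p∣ X) (trans (cong (_∸ ∣ X ∣) (sym ∣X∣+∣X∣≡n)) (m+n∸n≡m ∣ X ∣ ∣ X ∣))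
  deficit : ∣ X ∣ * ∣ X ∣ ≤ degreeSum G + k * (∣ X ∣ + ∣ X ∣)
  deficit = subst (λ D → ∣ X ∣ * ∣ X ∣ ≤ D + k * (∣ X ∣ + ∣ X ∣)) (sym (degreeSum≡2·edges G))
                  (h²≤2e+k·2h ∣ X ∣ (edges G) k δ ∣X∣+∣X∣≡n 2δn≡k e-lower)
... | G′ , (K4free′ , X-triangleFree′ , ∁X-triangleFree′) , α′ , h²≤D′ =
  G′ , (K4free′ , X , ∣X∣+∣X∣≡n , X-triangleFree′ , ∁X-triangleFree′) , α′ ,
  n²/8≤e ∣ X ∣ (edges G′) ∣X∣+∣X∣≡n (subst (∣ X ∣ * ∣ X ∣ ≤_) (degreeSum≡2·edges G′) h²≤D′)
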